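{- Let $n$ be odd and let $C=(C_0,C_1,\ldots,C_{k-1})$ be an equitable $k$-partition of the halved $n$-cube $\frac12 H(n)$ (whose vertices are the even-weight binary words of length $n$). For each $i$, let $C_i' = C_i\cup(C_i+\bar 1)$, where $\bar 1$ is the all-ones word and $C_i+\bar 1=\{\bar x+\bar 1:\bar x\in C_i\}$. Then $C'=(C'_0,\ldots,C'_{k-1})$ is an equitable $k$-partition of the $n$-cube $H(n)$.
   Context: The $n$-cube $H(n)$ is the graph on all binary words of length $n$ (vectors over GF$(2)$), two words adjacent iff they differ in exactly one position. The halved $n$-cube $\frac12 H(n)$ is the graph on the binary words of length $n$ with an even number of ones, two words adjacent iff they differ in exactly two positions. An equitable $k$-partition of a graph is an ordered partition $(C_0,\ldots,C_{k-1})$ of its vertex set (into cells) such that for all $i,j$ the number of neighbors in $C_j$ of a vertex of $C_i$ is a constant $S_{ij}$ not depending on the chosen vertex; $S=(S_{ij})$ is the quotient matrix. -}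

module Defs where

open import Data.Bool using (Bool; true; false; _∧_; _∨_; _xor_; not; T)
open import Data.Nat using (ℕ; zero; suc; _+_; _≡ᵇ_)
open import Data.Bool.Properties using (T?)
open import Data.Fin using (Fin)
open import Data.Vec using (Vec; []; _∷_; zipWith; replicate; count; toList)
open import Data.List using (List; []; _∷_; map; _++_; length; filter; allFin)
open import Data.Product using (Σ; _×_; _,_; ∃)
open import Relation.Binary.PropositionalEquality using (_≡_)
open import Relation.Nullary using (¬_)

Word : ℕ → Set
Word n = Vec Bool n

allWords : (n : ℕ) → List (Word n)
allWords zero = [] ∷ []
allWords (suc n) = map (false ∷_) (allWords n) ++ map (true ∷_) (allWords n)

_⊕_ : ∀ {n} → Word n → Word n → Word n
_⊕_ = zipWith _xor_

𝟙 : ∀ n → Word n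
𝟙 n = replicate n true

wt : ∀ {n} → Word n → ℕ
wt [] = 0
wt (true ∷ x) = suc (wt x)
wt (false ∷ x) = wt x

dist : ∀ {n} → Word n → Word n → ℕ
dist x y = wt (x ⊕ y)

isEvenᵇ : ℕ → Bool
isEvenᵇ zero = true
isEvenᵇ (suc m) = not (isEvenᵇ m)

record WordGraph (n : ℕ) : Set where
  field
    vtx : Word n → Bool
    adj : Word n → Word n → Bool
open WordGraph public

H : ∀ n → WordGraph n
H n = record { vtx = λ _ → true ; adj = λ x y → dist x y ≡ᵇ 1 }

halfH : ∀ n → WordGraph n
halfH n = record { vtx = λ x → isEvenᵇ (wt x) ; adj = λ x y → dist x y ≡ᵇ 2 }

-- An ordered k-partition of the vertex set given by cell membership
-- predicates  mem i x  (x ∈ C_i): every vertex lies in exactly one cell,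
-- non-vertices lie in no cell, and every cell is nonempty.
IsPartition : ∀ {n} (G : WordGraph n) (k : ℕ) → (Fin k → Word n → Bool) → Set
IsPartition {n} G k mem =
  (∀ (x : Word n) → T (vtx G x) → Σ (Fin k) λ i → T (mem i x) × (∀ j → T (mem j x) → j ≡ i))
  × (∀ (x : Word n) (i : Fin k) → T (mem i x) → T (vtx G x))
  × (∀ (i : Fin k) → ∃ λ (x : Word n) → T (mem i x))

nbrsIn : ∀ {n} (G : WordGraph n) → (Word n → Bool) → Word n → ℕ
nbrsIn {n} G P x = length (filter (λ y → T? (adj G x y ∧ P y)) (allWords n))

IsEquitable : ∀ {n} (G : WordGraph n) (k : ℕ) → (Fin k → Word n → Bool) → Set
IsEquitable {n} G k mem =
  IsPartition G k mem ×
  Σ (Fin k → Fin k → ℕ) λ S →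
    ∀ (i j : Fin k) (x : Word n) → T (mem i x) → nbrsIn G (mem j) x ≡ S i j

extend : ∀ {n k} → (Fin k → Word n → Bool) → (Fin k → Word n → Bool)
extend {n} mem i x = mem i x ∨ mem i (x ⊕ 𝟙 n)

-- For odd n, x ↦ x + 1̄ exchanges even and odd words. The H(n)-neighbours of an even word x
-- lying in C′_j are therefore exactly the words y + 1̄ with y ∈ C_j and dist x y = n − 1, and
-- odd words reduce to even ones by the same symmetry. So it suffices that the number of words of
-- C_j at distance n − 1 from x depends only on the cell of x.
--
-- Let S_d be summation over the Hamming sphere of radius d. Counting paths gives
-- S_1 S_{e+1} = (e+2) S_{e+2} + (n−e) S_e; in particular S_1 S_1 = 2 S_2 + n, and expanding
-- S_1 S_1 S_{f+2} writes 2 S_2 S_{f+2} + n S_{f+2} as (f+3)(f+4) S_{f+4} plus multiples of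
-- S_{f+2} and S_f. Equitability says exactly that S_2 maps functions constant on the cells (and
-- zero on odd words) to functions constant on the cells, so by induction over even radii every
-- S_d χ_j with d even, in particular d = n − 1, is constant on the cells.

module Submission where

open import Defs
open import Data.Bool using (Bool; true; false; not; _∧_; _∨_; _xor_; T)
open import Data.Bool.Properties
  using (T?; T-≡; T-∨; not-involutive; not-injective; not-distribˡ-xor; xor-comm)
open import Data.Fin using (Fin; zero; suc; punchIn; _≟_)
open import Data.Fin.Properties using (punchInᵢ≢i)
open import Data.List using (List; []; _∷_; map; _++_; length; filter)
open import Data.List.Properties using (filter-++; length-++)
open import Data.Nat using (ℕ; zero; suc; _+_; _*_; _∸_; _<_; _≤_; z≤n; s≤s; _≡ᵇ_; NonZero)
open import Data.Nat.Properties
  using ( +-commutativeSemigroup; +-0-commutativeMonoid; +-suc; +-comm; +-assoc; +-identityʳ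
        ; +-cancelʳ-≡; *-distribˡ-+; *-zeroʳ; *-identityʳ; *-cancelˡ-≡; m<n⇒m<1+n; n<1+n
        ; ≤-reflexive; suc-injective; 0∸n≡0)
open import Algebra.Properties.CommutativeMonoid.Sum +-0-commutativeMonoid
  using (sum; sum-cong-≗; sum-replicate-zero; sum-remove)
open import Algebra.Properties.CommutativeSemigroup +-commutativeSemigroup using (interchange)
open import Data.Nat.Solver using (module +-*-Solver)
open +-*-Solver using (solve; _:+_; _:*_; _:=_; con)
open import Data.Product using (Σ; _×_; _,_; proj₁; proj₂)
open import Data.Sum using (_⊎_; inj₁; inj₂)
open import Data.Unit using (tt)
open import Data.Vec using ([]; _∷_)
open import Data.Vec.Functional using (removeAt)
open import Function.Base using (_∘_)
open import Function.Bundles using (Equivalence)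
open import Relation.Binary.PropositionalEquality
  using (_≡_; _≢_; refl; sym; trans; cong; cong₂; module ≡-Reasoning)
open import Relation.Nullary using (contradiction; yes; no)
open import Relation.Nullary.Decidable using (isYes)

indicator : Bool → ℕ
indicator true = 1
indicator false = 0

indicator-∨ : ∀ a b → a ≡ false ⊎ b ≡ false → indicator (a ∨ b) ≡ indicator a + indicator b
indicator-∨ false b _ = refl
indicator-∨ true false _ = refl
indicator-∨ true true (inj₁ ())
indicator-∨ true true (inj₂ ())

not-flip : ∀ {a b} → not a ≡ b → a ≡ not b
not-flip {b = b} e = not-injective (trans e (sym (not-involutive b)))

not[b-xor-true]≡b : ∀ b → not (b xor true) ≡ b
not[b-xor-true]≡b true = refl
not[b-xor-true]≡b false = refl

xor≡false⇒≡ : ∀ a b → a xor b ≡ false → b ≡ a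
xor≡false⇒≡ true true _ = refl
xor≡false⇒≡ true false ()
xor≡false⇒≡ false true ()
xor≡false⇒≡ false false _ = refl

isEvenᵇ-+ : ∀ m n → isEvenᵇ (m + n) ≡ not (isEvenᵇ m) xor isEvenᵇ n
isEvenᵇ-+ zero n = refl
isEvenᵇ-+ (suc m) n =
  trans (cong not (isEvenᵇ-+ m n)) (not-distribˡ-xor (not (isEvenᵇ m)) (isEvenᵇ n))

isEvenᵇ-2+ : ∀ m → isEvenᵇ (2 + m) ≡ isEvenᵇ m
isEvenᵇ-2+ m = not-involutive (isEvenᵇ m)

[m∸1+n]*k+k≡[m∸n]*k : ∀ m n k → (m ≤ n → k ≡ 0) → (m ∸ suc n) * k + k ≡ (m ∸ n) * k
[m∸1+n]*k+k≡[m∸n]*k zero n k k≡0 rewrite k≡0 z≤n | 0∸n≡0 n = refl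
[m∸1+n]*k+k≡[m∸n]*k (suc m) zero k _ = +-comm (m * k) k
[m∸1+n]*k+k≡[m∸n]*k (suc m) (suc n) k k≡0 = [m∸1+n]*k+k≡[m∸n]*k m n k (k≡0 ∘ s≤s)

sum-zero : ∀ {k} (t : Fin k → ℕ) → (∀ l → t l ≡ 0) → sum t ≡ 0
sum-zero {k} t t≡0 = trans (sum-cong-≗ t≡0) (sum-replicate-zero k)

sum-δ : ∀ {k} (t : Fin k → ℕ) i → (∀ l → l ≢ i → t l ≡ 0) → sum t ≡ t i
sum-δ {suc k} t i t≡0 = begin
  sum t                     ≡⟨ sum-remove t ⟩
  t i + sum (removeAt t i)  ≡⟨ cong (t i +_) (sum-zero (removeAt t i) t∘punchIn≡0) ⟩
  t i + 0                   ≡⟨ +-identityʳ (t i) ⟩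
  t i                       ∎
  where
  open ≡-Reasoning
  t∘punchIn≡0 : ∀ l → t (punchIn i l) ≡ 0
  t∘punchIn≡0 l = t≡0 (punchIn i l) (punchInᵢ≢i i l)

count : ∀ {A : Set} → (A → Bool) → List A → ℕ
count p xs = length (filter (T? ∘ p) xs)

count-++ : ∀ {A : Set} (p : A → Bool) xs ys → count p (xs ++ ys) ≡ count p xs + count p ys
count-++ p xs ys =
  trans (cong length (filter-++ (T? ∘ p) xs ys)) (length-++ (filter (T? ∘ p) xs))

count-map : ∀ {A B : Set} (p : B → Bool) (f : A → B) xs → count p (map f xs) ≡ count (p ∘ f) xs
count-map p f [] = refl
count-map p f (x ∷ xs) with p (f x)
... | true = cong suc (count-map p f xs)
... | false = count-map p f xs

count-false : ∀ {A : Set} (xs : List A) → count (λ _ → false) xs ≡ 0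
count-false [] = refl
count-false (x ∷ xs) = count-false xs

wt-complement : ∀ {n} (x : Word n) → wt x + wt (x ⊕ 𝟙 n) ≡ n
wt-complement [] = refl
wt-complement (true ∷ x) = cong suc (wt-complement x)
wt-complement (false ∷ x) = trans (+-suc _ _) (cong suc (wt-complement x))

isEvenᵇ-wt-complement : ∀ {n} → isEvenᵇ n ≡ false → (x : Word n) →
                        isEvenᵇ (wt (x ⊕ 𝟙 n)) ≡ not (isEvenᵇ (wt x))
isEvenᵇ-wt-complement odd x = xor≡false⇒≡ _ _
  (trans (sym (isEvenᵇ-+ (wt x) _)) (trans (cong isEvenᵇ (wt-complement x)) odd))

⊕𝟙-involutive : ∀ {n} (x : Word n) → (x ⊕ 𝟙 n) ⊕ 𝟙 n ≡ x
⊕𝟙-involutive [] = refl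
⊕𝟙-involutive (true ∷ x) = cong (true ∷_) (⊕𝟙-involutive x)
⊕𝟙-involutive (false ∷ x) = cong (false ∷_) (⊕𝟙-involutive x)

VanishesAtParity : ∀ {n} → Bool → (Word n → ℕ) → Set
VanishesAtParity p g = ∀ y → isEvenᵇ (wt y) ≡ p → g y ≡ 0

vanishesAtParity-true∷ : ∀ {n} p {g : Word (suc n) → ℕ} →
                         VanishesAtParity p g → VanishesAtParity (not p) (g ∘ (true ∷_))
vanishesAtParity-true∷ p g≡0 y e = g≡0 (true ∷ y) (trans (cong not e) (not-involutive p))

-- sphereSum d g x = Σ { g y ∣ dist x y ≡ d }
sphereSum : ∀ {n} → ℕ → (Word n → ℕ) → Word n → ℕ
sphereSum zero g x = g x
sphereSum (suc d) g [] = 0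
sphereSum (suc d) g (b ∷ x) =
  sphereSum (suc d) (λ y → g (b ∷ y)) x + sphereSum d (λ y → g (not b ∷ y)) x

sphereSum-cong : ∀ {n} d {f h : Word n → ℕ} → (∀ y → f y ≡ h y) →
                 ∀ x → sphereSum d f x ≡ sphereSum d h x
sphereSum-cong zero f≗h x = f≗h x
sphereSum-cong (suc d) f≗h [] = refl
sphereSum-cong (suc d) f≗h (b ∷ x) =
  cong₂ _+_ (sphereSum-cong (suc d) (λ y → f≗h (b ∷ y)) x)
            (sphereSum-cong d (λ y → f≗h (not b ∷ y)) x)

sphereSum-0 : ∀ {n} d (x : Word n) → sphereSum d (λ _ → 0) x ≡ 0
sphereSum-0 zero x = refl
sphereSum-0 (suc d) [] = refl
sphereSum-0 (suc d) (b ∷ x) = cong₂ _+_ (sphereSum-0 (suc d) x) (sphereSum-0 d x)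

sphereSum-+ : ∀ {n} d (f h : Word n → ℕ) x →
              sphereSum d (λ y → f y + h y) x ≡ sphereSum d f x + sphereSum d h x
sphereSum-+ zero f h x = refl
sphereSum-+ (suc d) f h [] = refl
sphereSum-+ (suc d) f h (b ∷ x) =
  trans (cong₂ _+_ (sphereSum-+ (suc d) (λ y → f (b ∷ y)) (λ y → h (b ∷ y)) x)
                   (sphereSum-+ d (λ y → f (not b ∷ y)) (λ y → h (not b ∷ y)) x))
        (interchange (sphereSum (suc d) (λ y → f (b ∷ y)) x) (sphereSum (suc d) (λ y → h (b ∷ y)) x) _ _)

sphereSum-* : ∀ {n} d c (f : Word n → ℕ) x → sphereSum d (λ y → c * f y) x ≡ c * sphereSum d f x
sphereSum-* zero c f x = refl
sphereSum-* (suc d) c f [] = sym (*-zeroʳ c)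
sphereSum-* (suc d) c f (b ∷ x) =
  trans (cong₂ _+_ (sphereSum-* (suc d) c _ x) (sphereSum-* d c _ x)) (sym (*-distribˡ-+ c _ _))

sphereSum-sum : ∀ {n k} d (G : Fin k → Word n → ℕ) x →
                sphereSum d (λ y → sum (λ l → G l y)) x ≡ sum (λ l → sphereSum d (G l) x)
sphereSum-sum {k = zero} d G x = sphereSum-0 d x
sphereSum-sum {k = suc k} d G x =
  trans (sphereSum-+ d (G zero) (λ y → sum (λ l → G (suc l) y)) x)
        (cong (sphereSum d (G zero) x +_) (sphereSum-sum d (G ∘ suc) x))

sphereSum-beyond : ∀ {n} d (g : Word n → ℕ) x → n < d → sphereSum d g x ≡ 0
sphereSum-beyond (suc d) g [] _ = refl
sphereSum-beyond (suc d) g (b ∷ x) (s≤s n<d) =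
  cong₂ _+_ (sphereSum-beyond (suc d) _ x (m<n⇒m<1+n n<d)) (sphereSum-beyond d _ x n<d)

sphereSum-translate : ∀ {n} d (g : Word n → ℕ) (a x : Word n) →
                      sphereSum d (λ y → g (y ⊕ a)) x ≡ sphereSum d g (x ⊕ a)
sphereSum-translate zero g a x = refl
sphereSum-translate (suc d) g [] [] = refl
sphereSum-translate (suc d) g (c ∷ a) (b ∷ x) =
  cong₂ _+_ (sphereSum-translate (suc d) _ a x)
            (trans (sphereSum-translate d _ a x)
                   (sphereSum-cong d (λ y → cong (λ u → g (u ∷ y)) (sym (not-distribˡ-xor b c))) (x ⊕ a)))

sphereSum-antipodal : ∀ {n} d e → d + e ≡ n → (g : Word n → ℕ) (x : Word n) →
                      sphereSum d g (x ⊕ 𝟙 n) ≡ sphereSum e g x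
sphereSum-antipodal zero zero refl g [] = refl
sphereSum-antipodal {suc n} zero e refl g (b ∷ x) = begin
  g ((b xor true) ∷ (x ⊕ 𝟙 n))         ≡⟨ cong (λ u → g (u ∷ (x ⊕ 𝟙 n))) (xor-comm b true) ⟩
  g (not b ∷ (x ⊕ 𝟙 n))                ≡⟨ sphereSum-antipodal zero n refl g₁ x ⟩
  sphereSum n g₁ x                     ≡⟨ cong (_+ sphereSum n g₁ x) (sphereSum-beyond (suc n) _ x (n<1+n n)) ⟨
  sphereSum (suc n) g (b ∷ x)          ∎
  where
  open ≡-Reasoning
  g₁ : Word n → ℕ
  g₁ y = g (not b ∷ y)
sphereSum-antipodal {suc n} (suc d) zero 1+d+0≡1+n g (b ∷ x) = begin
  sphereSum (suc d) (λ y → g ((b xor true) ∷ y)) (x ⊕ 𝟙 n)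
    + sphereSum d (λ y → g (not (b xor true) ∷ y)) (x ⊕ 𝟙 n)
      ≡⟨ cong₂ _+_ (sphereSum-beyond (suc d) _ (x ⊕ 𝟙 n) (s≤s (≤-reflexive n≡d)))
                   (sphereSum-antipodal d zero d+0≡n _ x) ⟩
  g (not (b xor true) ∷ x)
      ≡⟨ cong (λ u → g (u ∷ x)) (not[b-xor-true]≡b b) ⟩
  g (b ∷ x) ∎
  where
  open ≡-Reasoning
  d+0≡n = suc-injective 1+d+0≡1+n
  n≡d = trans (sym d+0≡n) (+-identityʳ d)
sphereSum-antipodal {suc n} (suc d) (suc e) 1+d+1+e≡1+n g (b ∷ x) = begin
  sphereSum (suc d) (λ y → g ((b xor true) ∷ y)) (x ⊕ 𝟙 n)
    + sphereSum d (λ y → g (not (b xor true) ∷ y)) (x ⊕ 𝟙 n)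
      ≡⟨ cong₂ _+_ (sphereSum-antipodal (suc d) e (trans (sym (+-suc d e)) d+1+e≡n) _ x)
                   (sphereSum-antipodal d (suc e) d+1+e≡n _ x) ⟩
  sphereSum e (λ y → g ((b xor true) ∷ y)) x + sphereSum (suc e) (λ y → g (not (b xor true) ∷ y)) x
      ≡⟨ cong₂ _+_ (sphereSum-cong e (λ y → cong (λ u → g (u ∷ y)) (xor-comm b true)) x)
                   (sphereSum-cong (suc e) (λ y → cong (λ u → g (u ∷ y)) (not[b-xor-true]≡b b)) x) ⟩
  sphereSum e (λ y → g (not b ∷ y)) x + sphereSum (suc e) (λ y → g (b ∷ y)) x
      ≡⟨ +-comm (sphereSum e (λ y → g (not b ∷ y)) x) _ ⟩
  sphereSum (suc e) g (b ∷ x) ∎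
  where
  open ≡-Reasoning
  d+1+e≡n = suc-injective 1+d+1+e≡1+n

sphereSum-parity : ∀ {n} d p (g : Word n → ℕ) x →
                   VanishesAtParity p g → isEvenᵇ (d + wt x) ≡ p → sphereSum d g x ≡ 0
sphereSum-parity zero p g x g≡0 e = g≡0 x e
sphereSum-parity (suc d) p g [] g≡0 e = refl
sphereSum-parity (suc d) p g (false ∷ x) g≡0 e =
  cong₂ _+_ (sphereSum-parity (suc d) p _ x (λ y → g≡0 (false ∷ y)) e)
            (sphereSum-parity d (not p) _ x (vanishesAtParity-true∷ p g≡0) (not-flip e))
sphereSum-parity (suc d) p g (true ∷ x) g≡0 e =
  cong₂ _+_ (sphereSum-parity (suc d) (not p) _ x (vanishesAtParity-true∷ p g≡0) (not-flip e′))
            (sphereSum-parity d p _ x (λ y → g≡0 (false ∷ y)) (trans (sym (not-involutive _)) e′))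
  where
  e′ : not (isEvenᵇ (suc d + wt x)) ≡ p
  e′ = trans (cong isEvenᵇ (sym (+-suc (suc d) (wt x)))) e

-- A word at distance e + 2 from x has e + 2 neighbours on the sphere of radius e + 1 around x,
-- and a word at distance e has n − e of them.
sphereSum-1-recurrence : ∀ {n} e (g : Word n → ℕ) x →
  sphereSum 1 (sphereSum (suc e) g) x ≡ (2 + e) * sphereSum (2 + e) g x + (n ∸ e) * sphereSum e g x
sphereSum-1-recurrence e g [] rewrite *-zeroʳ (2 + e) | 0∸n≡0 e = refl
sphereSum-1-recurrence {suc n} e g (b ∷ x) = begin
  S 1 (λ y → S (suc e) g₀ y + S e g₁ y) x + (S (suc e) g₁ x + S e (λ y → g (not (not b) ∷ y)) x)
    ≡⟨ cong₂ _+_ (sphereSum-+ 1 (S (suc e) g₀) (S e g₁) x)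
                 (cong (S (suc e) g₁ x +_)
                       (sphereSum-cong e (λ y → cong (λ u → g (u ∷ y)) (not-involutive b)) x)) ⟩
  S 1 (S (suc e) g₀) x + S 1 (S e g₁) x + (S (suc e) g₁ x + S e g₀ x)
    ≡⟨ cong (λ u → u + S 1 (S e g₁) x + (S (suc e) g₁ x + S e g₀ x)) (sphereSum-1-recurrence e g₀ x) ⟩
  (2 + e) * S (2 + e) g₀ x + (n ∸ e) * S e g₀ x + S 1 (S e g₁) x + (S (suc e) g₁ x + S e g₀ x)
    ≡⟨ collect e ⟩
  (2 + e) * S (2 + e) g (b ∷ x) + (suc n ∸ e) * S e g (b ∷ x) ∎
  where
  open ≡-Reasoning
  S = sphereSum
  g₀ g₁ : Word n → ℕ
  g₀ y = g (b ∷ y)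
  g₁ y = g (not b ∷ y)
  collect : ∀ e →
    (2 + e) * S (2 + e) g₀ x + (n ∸ e) * S e g₀ x + S 1 (S e g₁) x + (S (suc e) g₁ x + S e g₀ x)
    ≡ (2 + e) * S (2 + e) g (b ∷ x) + (suc n ∸ e) * S e g (b ∷ x)
  collect zero = solve 4 (λ A B C n → con 2 :* A :+ n :* B :+ C :+ (C :+ B)
                                      := con 2 :* (A :+ C) :+ (con 1 :+ n) :* B)
                   refl (S 2 g₀ x) (g₀ x) (S 1 g₁ x) n
  collect (suc f) = begin
    (3 + f) * A + (n ∸ suc f) * B + S 1 (S (suc f) g₁) x + (C + B)
      ≡⟨ cong (λ u → (3 + f) * A + (n ∸ suc f) * B + u + (C + B)) (sphereSum-1-recurrence f g₁ x) ⟩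
    (3 + f) * A + (n ∸ suc f) * B + ((2 + f) * C + (n ∸ f) * D) + (C + B)
      ≡⟨ solve 7 (λ f A B C D u v →
                   (con 3 :+ f) :* A :+ u :* B :+ ((con 2 :+ f) :* C :+ v :* D) :+ (C :+ B)
                   := (con 3 :+ f) :* (A :+ C) :+ (u :* B :+ B) :+ v :* D)
               refl f A B C D (n ∸ suc f) (n ∸ f) ⟩
    (3 + f) * (A + C) + ((n ∸ suc f) * B + B) + (n ∸ f) * D
      ≡⟨ cong (λ u → (3 + f) * (A + C) + u + (n ∸ f) * D)
              ([m∸1+n]*k+k≡[m∸n]*k n f B (λ n≤f → sphereSum-beyond (suc f) g₀ x (s≤s n≤f))) ⟩
    (3 + f) * (A + C) + (n ∸ f) * B + (n ∸ f) * D
      ≡⟨ +-assoc ((3 + f) * (A + C)) _ _ ⟩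
    (3 + f) * (A + C) + ((n ∸ f) * B + (n ∸ f) * D)
      ≡⟨ cong ((3 + f) * (A + C) +_) (*-distribˡ-+ (n ∸ f) B D) ⟨
    (3 + f) * (A + C) + (n ∸ f) * (B + D) ∎
    where
    A = S (3 + f) g₀ x
    B = S (suc f) g₀ x
    C = S (2 + f) g₁ x
    D = S f g₁ x

sphereSum-2-recurrence : ∀ {n} f (g : Word n → ℕ) x →
  2 * sphereSum 2 (sphereSum (2 + f) g) x + n * sphereSum (2 + f) g x
  ≡ (3 + f) * (4 + f) * sphereSum (4 + f) g x
    + (((3 + f) * (n ∸ (2 + f)) + (n ∸ (1 + f)) * (2 + f)) * sphereSum (2 + f) g x
       + (n ∸ (1 + f)) * (n ∸ f) * sphereSum f g x)
sphereSum-2-recurrence {n} f g x = begin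
  2 * S 2 (S (2 + f) g) x + n * S (2 + f) g x
    ≡⟨ sphereSum-1-recurrence 0 (S (2 + f) g) x ⟨
  S 1 (S 1 (S (2 + f) g)) x
    ≡⟨ sphereSum-cong 1 (sphereSum-1-recurrence (suc f) g) x ⟩
  S 1 (λ y → (3 + f) * S (3 + f) g y + (n ∸ suc f) * S (suc f) g y) x
    ≡⟨ sphereSum-+ 1 (λ y → (3 + f) * S (3 + f) g y) (λ y → (n ∸ suc f) * S (suc f) g y) x ⟩
  S 1 (λ y → (3 + f) * S (3 + f) g y) x + S 1 (λ y → (n ∸ suc f) * S (suc f) g y) x
    ≡⟨ cong₂ _+_ (sphereSum-* 1 (3 + f) (S (3 + f) g) x)
                 (sphereSum-* 1 (n ∸ suc f) (S (suc f) g) x) ⟩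
  (3 + f) * S 1 (S (3 + f) g) x + (n ∸ suc f) * S 1 (S (suc f) g) x
    ≡⟨ cong₂ (λ u v → (3 + f) * u + (n ∸ suc f) * v)
             (sphereSum-1-recurrence (2 + f) g x) (sphereSum-1-recurrence f g x) ⟩
  (3 + f) * ((4 + f) * A + (n ∸ (2 + f)) * B) + (n ∸ suc f) * ((2 + f) * B + (n ∸ f) * D)
    ≡⟨ solve 9 (λ a b c e u v A B D →
                 a :* (b :* A :+ u :* B) :+ v :* (c :* B :+ e :* D)
                 := a :* b :* A :+ ((a :* u :+ v :* c) :* B :+ v :* e :* D))
             refl (3 + f) (4 + f) (2 + f) (n ∸ f) (n ∸ (2 + f)) (n ∸ suc f) A B D ⟩
  (3 + f) * (4 + f) * A
    + (((3 + f) * (n ∸ (2 + f)) + (n ∸ suc f) * (2 + f)) * B + (n ∸ suc f) * (n ∸ f) * D) ∎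
  where
  open ≡-Reasoning
  S = sphereSum
  A = S (4 + f) g x
  B = S (2 + f) g x
  D = S f g x

count-sphere : ∀ {n} d (P : Word n → Bool) x →
               count (λ y → (dist x y ≡ᵇ d) ∧ P y) (allWords n) ≡ sphereSum d (indicator ∘ P) x
count-sphere zero P [] with P []
... | true = refl
... | false = refl
count-sphere (suc d) P [] = refl
count-sphere {suc n} d P (b ∷ x) = begin
  count p (map (false ∷_) (allWords n) ++ map (true ∷_) (allWords n))
    ≡⟨ count-++ p (map (false ∷_) (allWords n)) _ ⟩
  count p (map (false ∷_) (allWords n)) + count p (map (true ∷_) (allWords n))
    ≡⟨ cong₂ _+_ (count-map p (false ∷_) (allWords n)) (count-map p (true ∷_) (allWords n)) ⟩
  count (p ∘ (false ∷_)) (allWords n) + count (p ∘ (true ∷_)) (allWords n)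
    ≡⟨ by-cases b d ⟩
  sphereSum d (indicator ∘ P) (b ∷ x) ∎
  where
  open ≡-Reasoning
  p : Word (suc n) → Bool
  p y = (dist (b ∷ x) y ≡ᵇ d) ∧ P y
  by-cases : ∀ b d → count (λ y → (dist (b ∷ x) (false ∷ y) ≡ᵇ d) ∧ P (false ∷ y)) (allWords n)
                   + count (λ y → (dist (b ∷ x) (true ∷ y) ≡ᵇ d) ∧ P (true ∷ y)) (allWords n)
                   ≡ sphereSum d (indicator ∘ P) (b ∷ x)
  by-cases false zero =
    trans (cong₂ _+_ (count-sphere zero (P ∘ (false ∷_)) x) (count-false (allWords n))) (+-identityʳ _)
  by-cases false (suc d) =
    cong₂ _+_ (count-sphere (suc d) (P ∘ (false ∷_)) x) (count-sphere d (P ∘ (true ∷_)) x)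
  by-cases true zero =
    trans (cong (_+ count (λ y → (dist x y ≡ᵇ 0) ∧ P (true ∷ y)) (allWords n)) (count-false (allWords n)))
          (count-sphere zero (P ∘ (true ∷_)) x)
  by-cases true (suc d) =
    trans (cong₂ _+_ (count-sphere d (P ∘ (false ∷_)) x) (count-sphere (suc d) (P ∘ (true ∷_)) x))
          (+-comm (sphereSum d (indicator ∘ P ∘ (false ∷_)) x) _)

module EquitablePartition {n k} (C : Fin k → Word n → Bool) (equitable : IsEquitable (halfH n) k C) where

  private
    M : Fin k → Fin k → ℕ
    M = proj₁ (proj₂ equitable)

  χ : Fin k → Word n → ℕ
  χ j y = indicator (C j y)

  rep : Fin k → Word n
  rep i = proj₁ (proj₂ (proj₂ (proj₁ equitable)) i)

  rep∈C : ∀ i → T (C i (rep i))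
  rep∈C i = proj₂ (proj₂ (proj₂ (proj₁ equitable)) i)

  C⇒even : ∀ {i x} → T (C i x) → isEvenᵇ (wt x) ≡ true
  C⇒even {i} {x} x∈Cᵢ = Equivalence.to T-≡ (proj₁ (proj₂ (proj₁ equitable)) x i x∈Cᵢ)

  odd⇒∉C : ∀ j y → isEvenᵇ (wt y) ≡ false → C j y ≡ false
  odd⇒∉C j y odd with C j y in y∈Cⱼ
  ... | false = refl
  ... | true with () ← trans (sym odd) (C⇒even (Equivalence.from T-≡ y∈Cⱼ))

  cellOf : ∀ x → isEvenᵇ (wt x) ≡ true → Σ (Fin k) λ i → T (C i x) × (∀ j → T (C j x) → j ≡ i)
  cellOf x even = proj₁ (proj₁ equitable) x (Equivalence.from T-≡ even)

  C-unique : ∀ {i j x} → T (C i x) → T (C j x) → j ≡ i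
  C-unique {i} {j} {x} x∈Cᵢ x∈Cⱼ with cellOf x (C⇒even x∈Cᵢ)
  ... | _ , _ , unique = trans (unique j x∈Cⱼ) (sym (unique i x∈Cᵢ))

  C-in-cell : ∀ {i x} j → T (C i x) → C j x ≡ isYes (j ≟ i)
  C-in-cell {i} {x} j x∈Cᵢ with j ≟ i
  ... | yes refl = Equivalence.to T-≡ x∈Cᵢ
  ... | no j≢i with C j x in x∈Cⱼ
  ...   | true = contradiction (C-unique x∈Cᵢ (Equivalence.from T-≡ x∈Cⱼ)) j≢i
  ...   | false = refl

  CellConstant : (Word n → ℕ) → Set
  CellConstant h = ∀ {i x x′} → T (C i x) → T (C i x′) → h x ≡ h x′

  EvenSupported : (Word n → ℕ) → Set
  EvenSupported = VanishesAtParity false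

  χ-evenSupported : ∀ j → EvenSupported (χ j)
  χ-evenSupported j y odd = cong indicator (odd⇒∉C j y odd)

  χ-cellConstant : ∀ j → CellConstant (χ j)
  χ-cellConstant j x∈Cᵢ x′∈Cᵢ =
    cong indicator (trans (C-in-cell j x∈Cᵢ) (sym (C-in-cell j x′∈Cᵢ)))

  sphereSum-2-χ : ∀ {i x} j → T (C i x) → sphereSum 2 (χ j) x ≡ M i j
  sphereSum-2-χ {i} {x} j x∈Cᵢ =
    trans (sym (count-sphere 2 (C j) x)) (proj₂ (proj₂ equitable) i j x x∈Cᵢ)

  cell-decomposition : ∀ {h} → EvenSupported h → CellConstant h →
                       ∀ y → h y ≡ sum (λ l → h (rep l) * χ l y)
  cell-decomposition {h} h-even h-const y with isEvenᵇ (wt y) in parity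
  ... | false = trans (h-even y parity) (sym (sum-zero _ terms≡0))
    where
    terms≡0 : ∀ l → h (rep l) * χ l y ≡ 0
    terms≡0 l = trans (cong (h (rep l) *_) (χ-evenSupported l y parity)) (*-zeroʳ (h (rep l)))
  ... | true with cellOf y parity
  ... | i , y∈Cᵢ , unique = sym (begin
    sum (λ l → h (rep l) * χ l y) ≡⟨ sum-δ _ i other-cells ⟩
    h (rep i) * χ i y             ≡⟨ cong (λ b → h (rep i) * indicator b) (Equivalence.to T-≡ y∈Cᵢ) ⟩
    h (rep i) * 1                 ≡⟨ *-identityʳ (h (rep i)) ⟩
    h (rep i)                     ≡⟨ h-const (rep∈C i) y∈Cᵢ ⟩
    h y                           ∎)
    where
    open ≡-Reasoning
    other-cells : ∀ l → l ≢ i → h (rep l) * χ l y ≡ 0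
    other-cells l l≢i with C l y in y∈Cₗ
    ... | true = contradiction (unique l (Equivalence.from T-≡ y∈Cₗ)) l≢i
    ... | false = *-zeroʳ (h (rep l))

  sphereSum-2-in-cell : ∀ {h i x} → EvenSupported h → CellConstant h → T (C i x) →
                        sphereSum 2 h x ≡ sum (λ l → h (rep l) * M i l)
  sphereSum-2-in-cell {h} {i} {x} h-even h-const x∈Cᵢ = begin
    sphereSum 2 h x
      ≡⟨ sphereSum-cong 2 (cell-decomposition h-even h-const) x ⟩
    sphereSum 2 (λ y → sum (λ l → h (rep l) * χ l y)) x
      ≡⟨ sphereSum-sum 2 (λ l y → h (rep l) * χ l y) x ⟩
    sum (λ l → sphereSum 2 (λ y → h (rep l) * χ l y) x)
      ≡⟨ sum-cong-≗ (λ l → sphereSum-* 2 (h (rep l)) (χ l) x) ⟩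
    sum (λ l → h (rep l) * sphereSum 2 (χ l) x)
      ≡⟨ sum-cong-≗ (λ l → cong (h (rep l) *_) (sphereSum-2-χ l x∈Cᵢ)) ⟩
    sum (λ l → h (rep l) * M i l) ∎
    where open ≡-Reasoning

  sphereSum-2-cellConstant : ∀ {h} → EvenSupported h → CellConstant h → CellConstant (sphereSum 2 h)
  sphereSum-2-cellConstant h-even h-const x∈Cᵢ x′∈Cᵢ =
    trans (sphereSum-2-in-cell h-even h-const x∈Cᵢ) (sym (sphereSum-2-in-cell h-even h-const x′∈Cᵢ))

  sphereSum-evenSupported : ∀ d {h} → isEvenᵇ d ≡ true → EvenSupported h →
                            EvenSupported (sphereSum d h)
  sphereSum-evenSupported d {h} d-even h-even y y-odd =
    sphereSum-parity d false h y h-even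
      (trans (isEvenᵇ-+ d (wt y)) (cong₂ (λ a b → not a xor b) d-even y-odd))

  cellConstant-cancel : ∀ c .{{_ : NonZero c}} {A R L : Word n → ℕ} → (∀ x → L x ≡ c * A x + R x) →
                        CellConstant L → CellConstant R → CellConstant A
  cellConstant-cancel c {A} {R} {L} L≡cA+R L-const R-const {x = x} {x′} x∈Cᵢ x′∈Cᵢ =
    *-cancelˡ-≡ (A x) (A x′) c (+-cancelʳ-≡ (R x) _ _ (begin
      c * A x + R x   ≡⟨ L≡cA+R x ⟨
      L x             ≡⟨ L-const x∈Cᵢ x′∈Cᵢ ⟩
      L x′            ≡⟨ L≡cA+R x′ ⟩
      c * A x′ + R x′ ≡⟨ cong (c * A x′ +_) (R-const x′∈Cᵢ x∈Cᵢ) ⟩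
      c * A x′ + R x  ∎))
    where open ≡-Reasoning

  sphereSum-4+-cellConstant : ∀ f {j} → isEvenᵇ f ≡ true →
                              CellConstant (sphereSum f (χ j)) → CellConstant (sphereSum (2 + f) (χ j)) →
                              CellConstant (sphereSum (4 + f) (χ j))
  sphereSum-4+-cellConstant f {j} f-even S_f-const S₂₊f-const =
    cellConstant-cancel ((3 + f) * (4 + f)) (sphereSum-2-recurrence f (χ j))
      (λ x∈Cᵢ x′∈Cᵢ → cong₂ (λ u v → 2 * u + n * v)
        (sphereSum-2-cellConstant S₂₊f-evenSupported S₂₊f-const x∈Cᵢ x′∈Cᵢ) (S₂₊f-const x∈Cᵢ x′∈Cᵢ))
      (λ x∈Cᵢ x′∈Cᵢ → cong₂ (λ u v → b * u + c * v) (S₂₊f-const x∈Cᵢ x′∈Cᵢ) (S_f-const x∈Cᵢ x′∈Cᵢ))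
    where
    b = (3 + f) * (n ∸ (2 + f)) + (n ∸ (1 + f)) * (2 + f)
    c = (n ∸ (1 + f)) * (n ∸ f)
    S₂₊f-evenSupported : EvenSupported (sphereSum (2 + f) (χ j))
    S₂₊f-evenSupported =
      sphereSum-evenSupported (2 + f) (trans (isEvenᵇ-2+ f) f-even) (χ-evenSupported j)

  sphereSum-even-cellConstant : ∀ d → isEvenᵇ d ≡ true → ∀ j → CellConstant (sphereSum d (χ j))
  sphereSum-even-cellConstant 0 _ j = χ-cellConstant j
  sphereSum-even-cellConstant 1 ()
  sphereSum-even-cellConstant 2 _ j = sphereSum-2-cellConstant (χ-evenSupported j) (χ-cellConstant j)
  sphereSum-even-cellConstant 3 ()
  sphereSum-even-cellConstant (suc (suc (suc (suc f)))) 4+f-even j =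
    sphereSum-4+-cellConstant f f-even
      (sphereSum-even-cellConstant f f-even j) (sphereSum-even-cellConstant (suc (suc f)) 2+f-even j)
    where
    2+f-even : isEvenᵇ (2 + f) ≡ true
    2+f-even = trans (sym (isEvenᵇ-2+ (2 + f))) 4+f-even
    f-even : isEvenᵇ f ≡ true
    f-even = trans (sym (isEvenᵇ-2+ f)) 2+f-even

module OddLength {m k} (C : Fin k → Word (suc m) → Bool) (equitable : IsEquitable (halfH (suc m)) k C)
                 (odd : isEvenᵇ (suc m) ≡ false) where

  open EquitablePartition C equitable

  private
    n : ℕ
    n = suc m

  complement-parity : ∀ x → isEvenᵇ (wt (x ⊕ 𝟙 n)) ≡ not (isEvenᵇ (wt x))
  complement-parity = isEvenᵇ-wt-complement odd

  evenOf : Word n → Word n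
  evenOf x with isEvenᵇ (wt x)
  ... | true = x
  ... | false = x ⊕ 𝟙 n

  evenOf-even : ∀ x → isEvenᵇ (wt (evenOf x)) ≡ true
  evenOf-even x with isEvenᵇ (wt x) in parity
  ... | true = parity
  ... | false = trans (complement-parity x) (cong not parity)

  extend⇒C : ∀ {j} x → T (extend C j x) → T (C j (evenOf x))
  extend⇒C {j} x x∈C′ⱼ with isEvenᵇ (wt x) in parity | Equivalence.to T-∨ x∈C′ⱼ
  ... | true | inj₁ x∈Cⱼ = x∈Cⱼ
  ... | true | inj₂ x̄∈Cⱼ with () ← trans (sym (C⇒even x̄∈Cⱼ)) (trans (complement-parity x) (cong not parity))
  ... | false | inj₁ x∈Cⱼ with () ← trans (sym (C⇒even x∈Cⱼ)) parity
  ... | false | inj₂ x̄∈Cⱼ = x̄∈Cⱼ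

  C⇒extend : ∀ {j} x → T (C j (evenOf x)) → T (extend C j x)
  C⇒extend x x̂∈Cⱼ with isEvenᵇ (wt x)
  ... | true = Equivalence.from T-∨ (inj₁ x̂∈Cⱼ)
  ... | false = Equivalence.from T-∨ (inj₂ x̂∈Cⱼ)

  extend-partition : IsPartition (H n) k (extend C)
  extend-partition = cover , (λ _ _ _ → tt) , λ i → rep i , Equivalence.from T-∨ (inj₁ (rep∈C i))
    where
    cover : ∀ x → T true → Σ (Fin k) λ i → T (extend C i x) × (∀ j → T (extend C j x) → j ≡ i)
    cover x _ with cellOf (evenOf x) (evenOf-even x)
    ... | i , x̂∈Cᵢ , unique = i , C⇒extend x x̂∈Cᵢ , λ j x∈C′ⱼ → unique j (extend⇒C x x∈C′ⱼ)

  nbrCount : Fin k → Word n → ℕ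
  nbrCount j x = sphereSum 1 (χ j) x + sphereSum 1 (χ j) (x ⊕ 𝟙 n)

  nbrsIn-extend : ∀ j x → nbrsIn (H n) (extend C j) x ≡ nbrCount j x
  nbrsIn-extend j x = begin
    nbrsIn (H n) (extend C j) x
      ≡⟨ count-sphere 1 (extend C j) x ⟩
    sphereSum 1 (indicator ∘ extend C j) x
      ≡⟨ sphereSum-cong 1 indicator-extend x ⟩
    sphereSum 1 (λ y → χ j y + χ j (y ⊕ 𝟙 n)) x
      ≡⟨ sphereSum-+ 1 (χ j) (λ y → χ j (y ⊕ 𝟙 n)) x ⟩
    sphereSum 1 (χ j) x + sphereSum 1 (λ y → χ j (y ⊕ 𝟙 n)) x
      ≡⟨ cong (sphereSum 1 (χ j) x +_) (sphereSum-translate 1 (χ j) (𝟙 n) x) ⟩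
    nbrCount j x ∎
    where
    open ≡-Reasoning
    indicator-extend : ∀ y → indicator (extend C j y) ≡ χ j y + χ j (y ⊕ 𝟙 n)
    indicator-extend y with isEvenᵇ (wt y) in parity
    ... | true = indicator-∨ (C j y) _
                   (inj₂ (odd⇒∉C j (y ⊕ 𝟙 n) (trans (complement-parity y) (cong not parity))))
    ... | false = indicator-∨ (C j y) _ (inj₁ (odd⇒∉C j y parity))

  nbrCount-evenOf : ∀ j x → nbrCount j (evenOf x) ≡ nbrCount j x
  nbrCount-evenOf j x with isEvenᵇ (wt x)
  ... | true = refl
  ... | false = trans (cong (λ z → sphereSum 1 (χ j) (x ⊕ 𝟙 n) + sphereSum 1 (χ j) z) (⊕𝟙-involutive x))
                      (+-comm (sphereSum 1 (χ j) (x ⊕ 𝟙 n)) _)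

  nbrCount-even : ∀ j x → isEvenᵇ (wt x) ≡ true → nbrCount j x ≡ sphereSum m (χ j) x
  nbrCount-even j x parity =
    cong₂ _+_ (sphereSum-parity 1 false (χ j) x (χ-evenSupported j) (cong not parity))
              (sphereSum-antipodal 1 m refl (χ j) x)

  extend-equitable : IsEquitable (H n) k (extend C)
  extend-equitable = extend-partition , (λ i j → sphereSum m (χ j) (rep i)) , counts
    where
    counts : ∀ i j x → T (extend C i x) → nbrsIn (H n) (extend C j) x ≡ sphereSum m (χ j) (rep i)
    counts i j x x∈C′ᵢ = begin
      nbrsIn (H n) (extend C j) x   ≡⟨ nbrsIn-extend j x ⟩
      nbrCount j x                  ≡⟨ nbrCount-evenOf j x ⟨
      nbrCount j (evenOf x)         ≡⟨ nbrCount-even j (evenOf x) (evenOf-even x) ⟩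
      sphereSum m (χ j) (evenOf x)
        ≡⟨ sphereSum-even-cellConstant m (not-flip odd) j (extend⇒C x x∈C′ᵢ) (rep∈C i) ⟩
      sphereSum m (χ j) (rep i)     ∎
      where open ≡-Reasoning

theorem1 : (n k : ℕ) → isEvenᵇ n ≡ false →
    (C : Fin k → Word n → Bool) → IsEquitable (halfH n) k C →
    IsEquitable (H n) k (extend C)
theorem1 zero k () C equitable
theorem1 (suc m) k odd C equitable = OddLength.extend-equitable C equitable odd
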